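{- Let $\Gamma$ be a $3$-colored totally symmetric colored graph (TSC-graph), and let $V$ be the finite vector space associated with $\Gamma$, i.e. the vertex set of $\Gamma$ is identified with a vector space $V=F_p^r$ ($p$ prime) such that $Aut(\Gamma)$ is an affine group on $V$ (it contains all translations of $V$ and its stabilizer of $0$ is contained in $GL(V)$). Then for every one-dimensional subspace $L$ of $V$ and all nonzero $u,v\in L$, the edges $\{0,v\}$ and $\{0,u\}$ have the same color.
   Context: A $k$-colored graph $\Gamma=(V,\psi)$ is a complete graph on a finite vertex set $V$ together with a surjective map $\psi$ from its set of edges onto the set of colors $\{0,1,\ldots,k-1\}$. The automorphism group $Aut(\Gamma)$ is the group of permutations of $V$ preserving the color of every edge. The extended automorphism group $Ext(\Gamma)$ is the group of permutations of $V$ that permute the color classes of edges. $\Gamma$ is edge-transitive if $Aut(\Gamma)$ is transitive on the set of edges of each color; $\Gamma$ is color-symmetric if $Ext(\Gamma)$ induces the full symmetric group on the set of colors; $\Gamma$ is totally symmetric (a TSC-graph) if it is both edge-transitive and color-symmetric. It is known that the automorphism group of a TSC-graph with at least two colors is an affine group, which gives the associated vector space. -}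

module Defs where

open import Data.Nat using (ℕ; _+_; _*_; NonZero)
open import Data.Nat.DivMod using (_mod_)
open import Data.Fin using (Fin; toℕ)
open import Data.Vec using (Vec; replicate; zipWith; map)
open import Data.Product using (Σ; ∃; _×_; _,_)
open import Data.Sum using (_⊎_)
open import Relation.Binary.PropositionalEquality using (_≡_; _≢_)
open import Function.Bundles using (_↔_; Inverse)

module _ {p : ℕ} .{{_ : NonZero p}} where

  _+F_ : Fin p → Fin p → Fin p
  a +F b = (toℕ a + toℕ b) mod p

  _*F_ : Fin p → Fin p → Fin p
  a *F b = (toℕ a * toℕ b) mod p

  zeroF : Fin p
  zeroF = 0 mod p

Vect : ℕ → ℕ → Set
Vect p r = Vec (Fin p) r

module _ {p r : ℕ} .{{_ : NonZero p}} where

  0V : Vect p r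
  0V = replicate r zeroF

  _+V_ : Vect p r → Vect p r → Vect p r
  _+V_ = zipWith _+F_

  _·V_ : Fin p → Vect p r → Vect p r
  a ·V x = map (a *F_) x

  _∈Span_ : Vect p r → Vect p r → Set
  u ∈Span w = ∃ λ (a : Fin p) → u ≡ a ·V w

-- A k-colored complete graph on vertex set V: a symmetric colouring of the
-- pairs of distinct vertices (values on the diagonal are irrelevant),
-- surjective onto the k colours.
record ColoredGraph (V : Set) (k : ℕ) : Set where
  field
    ψ    : V → V → Fin k
    sym  : ∀ x y → x ≢ y → ψ x y ≡ ψ y x
    surj : ∀ (c : Fin k) → ∃ λ x → ∃ λ y → x ≢ y × ψ x y ≡ c

module _ {V : Set} {k : ℕ} (Γ : ColoredGraph V k) where
  open ColoredGraph Γ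

  IsAut : (V ↔ V) → Set
  IsAut σ = ∀ x y → x ≢ y → ψ (Inverse.to σ x) (Inverse.to σ y) ≡ ψ x y

  Induces : (V ↔ V) → (Fin k ↔ Fin k) → Set
  Induces σ π = ∀ x y → x ≢ y →
    ψ (Inverse.to σ x) (Inverse.to σ y) ≡ Inverse.to π (ψ x y)

  MapsEdge : (V ↔ V) → V → V → V → V → Set
  MapsEdge σ x y x' y' =
    (Inverse.to σ x ≡ x' × Inverse.to σ y ≡ y') ⊎
    (Inverse.to σ x ≡ y' × Inverse.to σ y ≡ x')

  EdgeTransitive : Set
  EdgeTransitive = ∀ x y x' y' → x ≢ y → x' ≢ y' → ψ x y ≡ ψ x' y' →
    ∃ λ (σ : V ↔ V) → IsAut σ × MapsEdge σ x y x' y'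

  ColorSymmetric : Set
  ColorSymmetric = ∀ (π : Fin k ↔ Fin k) → ∃ λ (σ : V ↔ V) → Induces σ π

  TotallySymmetric : Set
  TotallySymmetric = EdgeTransitive × ColorSymmetric

module _ {p r : ℕ} .{{_ : NonZero p}} (Γ : ColoredGraph (Vect p r) 3) where


  ContainsTranslations : Set
  ContainsTranslations = ∀ (t : Vect p r) →
    ∃ λ (σ : Vect p r ↔ Vect p r) → IsAut Γ σ × (∀ x → Inverse.to σ x ≡ x +V t)

  StabilizerLinear : Set
  StabilizerLinear = ∀ (σ : Vect p r ↔ Vect p r) → IsAut Γ σ → Inverse.to σ 0V ≡ 0V →
    (∀ x y → Inverse.to σ (x +V y) ≡ Inverse.to σ x +V Inverse.to σ y) ×
    (∀ a x → Inverse.to σ (a ·V x) ≡ a ·V Inverse.to σ x)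

  AffineAut : Set
  AffineAut = ContainsTranslations × StabilizerLinear

module Submission where

open import Defs
open import Data.Nat using (ℕ; NonZero)
open import Data.Nat.Primality using (Prime)
open import Relation.Binary.PropositionalEquality using (_≡_; _≢_)

open import Algebra.Bundles using (AbelianGroup)
open import Data.Empty using (⊥)
open import Data.Fin using (Fin; toℕ; _≟_)
import Data.Fin as Fin
open import Data.Fin.Patterns using (0F; 1F; 2F)
open import Data.Fin.Permutation using (Permutation′; _⟨$⟩ʳ_; transpose)
open import Data.Fin.Properties using (toℕ-injective; toℕ-fromℕ<; toℕ<n)
open import Data.Nat using (zero; suc; _+_; _*_; _∸_; _%_; _/_; _<_; s≤s; >-nonZero⁻¹; nonTrivial⇒n>1)
import Data.Nat as ℕ
open import Data.Nat.DivMod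
open import Data.Nat.Divisibility using (m%n≡0⇒n∣m)
open import Data.Nat.Primality using (composite-≢; prime⇒nonTrivial)
open import Data.Nat.Properties using (+-comm; +-assoc; +-identityʳ; *-identityˡ; m+[n∸m]≡n; <⇒≤)
open import Data.Product using (∃; _×_; _,_; proj₁; proj₂)
open import Data.Sum using (_⊎_; inj₁; inj₂; [_,_])
open import Data.Vec using (Vec; []; _∷_; map; zipWith)
open import Data.Vec.Properties
  using (≡-dec; map-cong; map-id; map-const; zipWith-assoc; zipWith-comm; zipWith-identityˡ;
         zipWith-identityʳ; zipWith-inverseˡ; zipWith-inverseʳ)
open import Function using (_∘_; id; flip)
open import Function.Bundles using (_↔_; Inverse; Injection)
open import Function.Construct.Composition using (_↔-∘_)
open import Function.Construct.Symmetry using (↔-sym)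
open import Function.Properties.Inverse using (↔⇒↣)
open import Relation.Nullary using (¬_; yes; no)
open import Relation.Nullary.Decidable using (dec-true; decidable-stable)
open import Relation.Nullary.Negation using (¬¬-map; contradiction; contraposition)
open import Relation.Binary.PropositionalEquality
  using (refl; sym; trans; cong; cong₂; subst; subst₂; isEquivalence; module ≡-Reasoning)

open Inverse using (to; from; strictlyInverseˡ; strictlyInverseʳ)

-- Let c be the colour of w and suppose a·w has a different colour d. Pick a colour permutation π
-- fixing c and moving d, and σ ∈ Ext(Γ) fixing 0 that induces it. If σ is additive, then
-- σ(a·w) = a·σ(w) has colour π d ≠ d; but σ(w) has colour c, and since the stabiliser of 0 is
-- linear and transitive on each colour class up to sign, a·σ(w) has the colour d of a·w.
--
-- Additivity of σ: σ normalises Aut(Γ), so σ τₓ σ⁻¹ is τ_{σx} composed with a linear map, and the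
-- set K of x along which σ is additive is a subgroup stable under the stabiliser of 0. If K ≠ V, a
-- commutator of translations with their σ-conjugates produces a nonzero vector of K, so K contains
-- the subgroup generated by a whole colour class. Ext(Γ) permutes these three subgroups transitively
-- and they cover V, so they all equal V, because for odd p a vector space over F_p is not the union
-- of three proper subgroups (for p = 2 the only nonzero multiple of w is w itself).
--
-- Picking points outside a subgroup is not constructive, so the argument runs in the double-negation
-- monad; the final equality of colours is decidable.

¬¬-Shift : Set → Set₁
¬¬-Shift A = ∀ {P : A → Set} → (∀ x → ¬ ¬ P x) → ¬ ¬ (∀ x → P x)

¬¬-shift-Fin : ∀ n → ¬¬-Shift (Fin n)
¬¬-shift-Fin zero h ¬all = ¬all λ ()
¬¬-shift-Fin (suc n) h ¬all =
  h 0F λ P0 → ¬¬-shift-Fin n (h ∘ Fin.suc) λ Psuc → ¬all λ { 0F → P0 ; (Fin.suc i) → Psuc i }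

¬¬-shift-Vec : ∀ {A} → ¬¬-Shift A → ∀ r → ¬¬-Shift (Vec A r)
¬¬-shift-Vec shift zero h ¬all = h [] λ P[] → ¬all λ { [] → P[] }
¬¬-shift-Vec shift (suc r) {P} h ¬all =
  shift {λ a → ∀ xs → P (a ∷ xs)} (λ a → ¬¬-shift-Vec shift r (h ∘ (a ∷_)))
        λ all → ¬all λ { (a ∷ xs) → all a xs }

¬∀⇒¬¬∃¬ : ∀ {A} → ¬¬-Shift A → ∀ {P : A → Set} → ¬ (∀ x → P x) → ¬ ¬ (∃ λ x → ¬ P x)
¬∀⇒¬¬∃¬ shift ¬all ¬∃ = shift (λ x ¬Px → ¬∃ (x , ¬Px)) ¬all

transpose-sends : ∀ {n} (i j : Fin n) → transpose i j ⟨$⟩ʳ i ≡ j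
transpose-sends i j rewrite dec-true (i ≟ i) refl = refl

fix-and-move : (c d : Fin 3) → c ≢ d → ∃ λ (π : Permutation′ 3) → π ⟨$⟩ʳ c ≡ c × π ⟨$⟩ʳ d ≢ d
fix-and-move 0F 0F c≢d = contradiction refl c≢d
fix-and-move 0F 1F _ = transpose 1F 2F , refl , λ ()
fix-and-move 0F 2F _ = transpose 1F 2F , refl , λ ()
fix-and-move 1F 0F _ = transpose 0F 2F , refl , λ ()
fix-and-move 1F 1F c≢d = contradiction refl c≢d
fix-and-move 1F 2F _ = transpose 0F 2F , refl , λ ()
fix-and-move 2F 0F _ = transpose 0F 1F , refl , λ ()
fix-and-move 2F 1F _ = transpose 0F 1F , refl , λ ()
fix-and-move 2F 2F c≢d = contradiction refl c≢d

-- For odd p = 1 + 2h, the inverse of 2 is h + 1.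
prime≢2⇒½ : ∀ {p} .{{_ : NonZero p}} → Prime p → p ≢ 2 → ∃ λ m → (m * 2) % p ≡ 1
prime≢2⇒½ {p} p-prime p≢2 with p % 2 in p%2 | m%n<n p 2 | m≡m%n+[m/n]*n p 2
... | 0 | _ | _ = contradiction (composite-≢ 2 (p≢2 ∘ sym) (m%n≡0⇒n∣m p 2 p%2)) (Prime.notComposite p-prime)
... | 1 | _ | p≡1+h*2 = suc (p / 2) , (begin
  (1 + (1 + p / 2 * 2)) % p  ≡⟨ cong (λ n → (1 + n) % p) p≡1+h*2 ⟨
  (1 + p) % p                ≡⟨ [m+n]%n≡m%n 1 p ⟩
  1 % p                      ≡⟨ m<n⇒m%n≡m (nonTrivial⇒n>1 p {{prime⇒nonTrivial p-prime}}) ⟩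
  1                          ∎)
  where open ≡-Reasoning
... | suc (suc _) | s≤s (s≤s ()) | _

to-injective : ∀ {A : Set} (f : A ↔ A) {x y} → to f x ≡ to f y → x ≡ y
to-injective f = Injection.injective (↔⇒↣ f)

to-≢ : ∀ {A : Set} (f : A ↔ A) {x y} → x ≢ y → to f x ≢ to f y
to-≢ f = contraposition (to-injective f)

module _ {p : ℕ} .{{_ : NonZero p}} where

  toℕ-mod : ∀ n → toℕ (n mod p) ≡ n % p
  toℕ-mod n = toℕ-fromℕ< (m%n<n n p)

  mod-toℕ : ∀ (a : Fin p) → toℕ a mod p ≡ a
  mod-toℕ a = toℕ-injective (trans (toℕ-mod (toℕ a)) (m<n⇒m%n≡m (toℕ<n a)))

  mod-cong : ∀ {m n} → m % p ≡ n % p → m mod p ≡ n mod p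
  mod-cong {m} {n} eq = toℕ-injective (trans (toℕ-mod m) (trans eq (sym (toℕ-mod n))))

  mod-homo-+ : ∀ m n → (m + n) mod p ≡ (m mod p) +F (n mod p)
  mod-homo-+ m n = mod-cong (begin
    (m + n) % p                           ≡⟨ %-distribˡ-+ m n p ⟩
    (m % p + n % p) % p                   ≡⟨ cong₂ (λ a b → (a + b) % p) (toℕ-mod m) (toℕ-mod n) ⟨
    (toℕ (m mod p) + toℕ (n mod p)) % p   ∎)
    where open ≡-Reasoning

  -F_ : Fin p → Fin p
  -F a = (p ∸ toℕ a) mod p

  _·ℕ_ : ℕ → Fin p → Fin p
  n ·ℕ a = (n * toℕ a) mod p

  +F-comm : ∀ (a b : Fin p) → a +F b ≡ b +F a
  +F-comm a b = cong (_mod p) (+-comm (toℕ a) (toℕ b))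

  +F-assoc : ∀ (a b c : Fin p) → (a +F b) +F c ≡ a +F (b +F c)
  +F-assoc a b c = begin
    (a +F b) +F c                               ≡⟨ cong ((a +F b) +F_) (mod-toℕ c) ⟨
    ((toℕ a + toℕ b) mod p) +F (toℕ c mod p)    ≡⟨ mod-homo-+ (toℕ a + toℕ b) (toℕ c) ⟨
    (toℕ a + toℕ b + toℕ c) mod p               ≡⟨ cong (_mod p) (+-assoc (toℕ a) (toℕ b) (toℕ c)) ⟩
    (toℕ a + (toℕ b + toℕ c)) mod p             ≡⟨ mod-homo-+ (toℕ a) (toℕ b + toℕ c) ⟩
    (toℕ a mod p) +F (b +F c)                   ≡⟨ cong (_+F (b +F c)) (mod-toℕ a) ⟩
    a +F (b +F c)                               ∎
    where open ≡-Reasoning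

  +F-identityʳ : ∀ (a : Fin p) → a +F zeroF ≡ a
  +F-identityʳ a = begin
    a +F (0 mod p)                 ≡⟨ cong (_+F (0 mod p)) (mod-toℕ a) ⟨
    (toℕ a mod p) +F (0 mod p)     ≡⟨ mod-homo-+ (toℕ a) 0 ⟨
    (toℕ a + 0) mod p              ≡⟨ cong (_mod p) (+-identityʳ (toℕ a)) ⟩
    toℕ a mod p                    ≡⟨ mod-toℕ a ⟩
    a                              ∎
    where open ≡-Reasoning

  +F-inverseʳ : ∀ (a : Fin p) → a +F (-F a) ≡ zeroF
  +F-inverseʳ a = begin
    a +F (-F a)                             ≡⟨ cong (_+F (-F a)) (mod-toℕ a) ⟨
    (toℕ a mod p) +F ((p ∸ toℕ a) mod p)    ≡⟨ mod-homo-+ (toℕ a) (p ∸ toℕ a) ⟨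
    (toℕ a + (p ∸ toℕ a)) mod p             ≡⟨ cong (_mod p) (m+[n∸m]≡n (<⇒≤ (toℕ<n a))) ⟩
    p mod p                                 ≡⟨ mod-cong (trans (n%n≡0 p) (sym (m<n⇒m%n≡m (>-nonZero⁻¹ p)))) ⟩
    zeroF                                   ∎
    where open ≡-Reasoning

  +F-·ℕ : ∀ n (a : Fin p) → a +F (n ·ℕ a) ≡ suc n ·ℕ a
  +F-·ℕ n a = trans (cong (_+F (n ·ℕ a)) (sym (mod-toℕ a))) (sym (mod-homo-+ (toℕ a) (n * toℕ a)))

  ·ℕ-½ : ∀ m → (m * 2) % p ≡ 1 → ∀ (a : Fin p) → (m * 2) ·ℕ a ≡ a
  ·ℕ-½ m 2m≡1 a = trans (mod-cong (begin
    (m * 2 * toℕ a) % p                 ≡⟨ %-distribˡ-* (m * 2) (toℕ a) p ⟩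
    ((m * 2) % p * (toℕ a % p)) % p     ≡⟨ cong (λ k → (k * (toℕ a % p)) % p) 2m≡1 ⟩
    (1 * (toℕ a % p)) % p               ≡⟨ cong (_% p) (*-identityˡ (toℕ a % p)) ⟩
    toℕ a % p % p                       ≡⟨ m%n%n≡m%n (toℕ a) p ⟩
    toℕ a % p                           ∎)) (mod-toℕ a)
    where open ≡-Reasoning

Vect-abelianGroup : (p r : ℕ) .{{_ : NonZero p}} → AbelianGroup _ _
Vect-abelianGroup p r = record
  { Carrier = Vect p r
  ; _≈_ = _≡_
  ; _∙_ = _+V_
  ; ε = 0V
  ; _⁻¹ = map -F_
  ; isAbelianGroup = record
    { isGroup = record
      { isMonoid = record
        { isSemigroup = record
          { isMagma = record { isEquivalence = isEquivalence ; ∙-cong = cong₂ _+V_ }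
          ; assoc = zipWith-assoc +F-assoc
          }
        ; identity = zipWith-identityˡ (λ a → trans (+F-comm zeroF a) (+F-identityʳ a))
                   , zipWith-identityʳ +F-identityʳ
        }
      ; inverse = zipWith-inverseˡ (λ a → trans (+F-comm (-F a) a) (+F-inverseʳ a))
                , zipWith-inverseʳ +F-inverseʳ
      ; ⁻¹-cong = cong (map -F_)
      }
    ; comm = zipWith-comm +F-comm
    }
  }

module VectorSpace (p r : ℕ) .{{_ : NonZero p}} where

  open AbelianGroup (Vect-abelianGroup p r) public
    using ()
    renaming (assoc to +V-assoc; comm to +V-comm; identityˡ to +V-identityˡ; identityʳ to +V-identityʳ;
              inverseʳ to +V-inverseʳ)
  open import Algebra.Properties.AbelianGroup (Vect-abelianGroup p r) public
  open import Algebra.Properties.CommutativeSemigroup (AbelianGroup.commutativeSemigroup (Vect-abelianGroup p r)) public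
  open import Algebra.Properties.CommutativeMonoid.Mult (AbelianGroup.commutativeMonoid (Vect-abelianGroup p r)) public
    renaming (_×_ to _×V_)

  V : Set
  V = Vect p r

  -V_ : V → V
  -V_ = map -F_

  _-V_ : V → V → V
  x -V y = x +V (-V y)

  V-¬¬-shift : ¬¬-Shift V
  V-¬¬-shift = ¬¬-shift-Vec (¬¬-shift-Fin p) r

  V-¬∀⇒¬¬∃¬ : ∀ {P : V → Set} → ¬ (∀ x → P x) → ¬ ¬ (∃ λ x → ¬ P x)
  V-¬∀⇒¬¬∃¬ = ¬∀⇒¬¬∃¬ V-¬¬-shift

  x+[y-x]≡y : ∀ x y → x +V (y -V x) ≡ y
  x+[y-x]≡y x y = trans (+V-comm x (y -V x)) (//-rightDividesˡ x y)

  [x+y]-x≡y : ∀ x y → (x +V y) -V x ≡ y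
  [x+y]-x≡y x y = trans (cong (_-V x) (+V-comm x y)) (//-rightDividesʳ x y)

  -V-≢0 : ∀ {z} → z ≢ 0V → -V z ≢ 0V
  -V-≢0 {z} z≢0 -z≡0 = z≢0 (trans (sym (⁻¹-involutive z)) (trans (cong -V_ -z≡0) ε⁻¹≈ε))

  ×V-as-map : ∀ n (x : V) → n ×V x ≡ map (n ·ℕ_) x
  ×V-as-map zero x = sym (map-const x zeroF)
  ×V-as-map (suc n) x = trans (cong (x +V_) (×V-as-map n x)) (add-pointwise x)
    where
    add-pointwise : ∀ {k} (x : Vect p k) → zipWith _+F_ x (map (n ·ℕ_) x) ≡ map (suc n ·ℕ_) x
    add-pointwise [] = refl
    add-pointwise (c ∷ x) = cong₂ _∷_ (+F-·ℕ n c) (add-pointwise x)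

  ·V-as-×V : ∀ a (x : V) → a ·V x ≡ toℕ a ×V x
  ·V-as-×V a x = sym (×V-as-map (toℕ a) x)

  ×V-½ : ∀ m → (m * 2) % p ≡ 1 → ∀ (x : V) → m ×V (x +V x) ≡ x
  ×V-½ m 2m≡1 x = begin
    m ×V (x +V x)           ≡⟨ cong (λ y → m ×V (x +V y)) (+V-identityʳ x) ⟨
    m ×V (2 ×V x)           ≡⟨ ×-assocˡ x m 2 ⟩
    (m * 2) ×V x            ≡⟨ ×V-as-map (m * 2) x ⟩
    map ((m * 2) ·ℕ_) x     ≡⟨ map-cong (·ℕ-½ m 2m≡1) x ⟩
    map id x                ≡⟨ map-id x ⟩
    x                       ∎
    where open ≡-Reasoning

  ·V-over-F₂ : p ≡ 2 → ∀ a (x : V) → a ·V x ≡ 0V ⊎ a ·V x ≡ x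
  ·V-over-F₂ p≡2 a x rewrite ·V-as-×V a x with toℕ a | subst (toℕ a <_) p≡2 (toℕ<n a)
  ... | 0 | _ = inj₁ refl
  ... | 1 | _ = inj₂ (×-homo-1 x)
  ... | suc (suc _) | s≤s (s≤s ())

  Additive : (V → V) → Set
  Additive f = ∀ x y → f (x +V y) ≡ f x +V f y

  module _ {f : V → V} (f-additive : Additive f) where

    additive⇒0 : f 0V ≡ 0V
    additive⇒0 = identityʳ-unique (f 0V) (f 0V) (trans (sym (f-additive 0V 0V)) (cong f (+V-identityʳ 0V)))

    additive⇒-V : ∀ x → f (-V x) ≡ -V f x
    additive⇒-V x = inverseʳ-unique (f x) (f (-V x))
      (trans (sym (f-additive x (-V x))) (trans (cong f (+V-inverseʳ x)) additive⇒0))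

    additive⇒×V : ∀ n x → f (n ×V x) ≡ n ×V f x
    additive⇒×V zero x = additive⇒0
    additive⇒×V (suc n) x = trans (f-additive x (n ×V x)) (cong (f x +V_) (additive⇒×V n x))

    additive⇒·V : ∀ a x → f (a ·V x) ≡ a ·V f x
    additive⇒·V a x = begin
      f (a ·V x)       ≡⟨ cong f (·V-as-×V a x) ⟩
      f (toℕ a ×V x)   ≡⟨ additive⇒×V (toℕ a) x ⟩
      toℕ a ×V f x     ≡⟨ ·V-as-×V a (f x) ⟨
      a ·V f x         ∎
      where open ≡-Reasoning

  ·V-additive : ∀ a → Additive (a ·V_)
  ·V-additive a x y = begin
    a ·V (x +V y)                  ≡⟨ ·V-as-×V a (x +V y) ⟩
    toℕ a ×V (x +V y)              ≡⟨ ×-distrib-+ x y (toℕ a) ⟩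
    (toℕ a ×V x) +V (toℕ a ×V y)   ≡⟨ cong₂ _+V_ (·V-as-×V a x) (·V-as-×V a y) ⟨
    (a ·V x) +V (a ·V y)           ∎
    where open ≡-Reasoning

  record IsSubgroup (X : V → Set) : Set where
    field
      0∈ : X 0V
      +∈ : ∀ {x y} → X x → X y → X (x +V y)
      -∈ : ∀ {x} → X x → X (-V x)

    ×∈ : ∀ n {x} → X x → X (n ×V x)
    ×∈ zero x∈ = 0∈
    ×∈ (suc n) x∈ = +∈ x∈ (×∈ n x∈)

    -∈-∈ : ∀ {x y} → X x → X y → X (y -V x)
    -∈-∈ x∈ y∈ = +∈ y∈ (-∈ x∈)

    ∈-∉⇒+∉ : ∀ {u d} → X u → ¬ X d → ¬ X (u +V d)
    ∈-∉⇒+∉ {u} {d} u∈ d∉ u+d∈ = d∉ (subst X ([x+y]-x≡y u d) (-∈-∈ u∈ u+d∈))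

    ∉-∈⇒+∉ : ∀ {u d} → ¬ X u → X d → ¬ X (u +V d)
    ∉-∈⇒+∉ {u} {d} u∉ d∈ u+d∈ = u∉ (subst X (//-rightDividesʳ d u) (-∈-∈ d∈ u+d∈))

    ½∈ : ∀ m → (m * 2) % p ≡ 1 → ∀ {x} → X (x +V x) → X x
    ½∈ m 2m≡1 {x} x+x∈ = subst X (×V-½ m 2m≡1 x) (×∈ m x+x∈)

    ±∈ : ∀ {u t} → X u → u ≡ t ⊎ u ≡ -V t → X t
    ±∈ u∈ (inj₁ refl) = u∈
    ±∈ {t = t} u∈ (inj₂ refl) = subst X (⁻¹-involutive t) (-∈ u∈)

  two-proper-subgroups-miss : ∀ {A B} → IsSubgroup A → IsSubgroup B →
    ¬ (∀ z → A z) → ¬ (∀ z → B z) → ¬ (∀ z → A z ⊎ B z)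
  two-proper-subgroups-miss {A} {B} A-subgroup B-subgroup not-all-A not-all-B A∪B =
    V-¬∀⇒¬¬∃¬ not-all-A λ (a , a∉A) → V-¬∀⇒¬¬∃¬ not-all-B λ (b , b∉B) →
      let b∈A = [ id , flip contradiction b∉B ] (A∪B b)
          a∈B = [ flip contradiction a∉A , id ] (A∪B a)
      in [ IsSubgroup.∈-∉⇒+∉ A-subgroup b∈A a∉A ∘ subst A (+V-comm a b)
         , IsSubgroup.∈-∉⇒+∉ B-subgroup a∈B b∉B ] (A∪B (a +V b))

  -- Some d ∉ A ∪ B lies in C. If e ∉ C, then e, e + d, e + 2d all avoid C, and two consecutive ones,
  -- or the two ends, lie in the same subgroup A or B, which then contains d or 2d.
  three-subgroup-cover⇒third-total : ∀ m → (m * 2) % p ≡ 1 → ∀ {A B C} →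
    IsSubgroup A → IsSubgroup B → IsSubgroup C → (∀ z → A z ⊎ B z ⊎ C z) →
    ¬ (∀ z → A z) → ¬ (∀ z → B z) → ¬ ¬ (∀ z → C z)
  three-subgroup-cover⇒third-total m 2m≡1 {A} {B} {C}
    A-subgroup B-subgroup C-subgroup A∪B∪C not-all-A not-all-B not-all-C =
    V-¬∀⇒¬¬∃¬ (two-proper-subgroups-miss A-subgroup B-subgroup not-all-A not-all-B) λ (d , d∉A∪B) →
      V-¬¬-shift (λ e → three-points d∉A∪B (d∈C d∉A∪B)) not-all-C
    where
    open IsSubgroup
    d∈C : ∀ {d} → ¬ (A d ⊎ B d) → C d
    d∈C {d} d∉A∪B = [ flip contradiction (d∉A∪B ∘ inj₁) , [ flip contradiction (d∉A∪B ∘ inj₂) , id ] ] (A∪B∪C d)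
    A∪B : ∀ {z} → ¬ C z → A z ⊎ B z
    A∪B {z} z∉C = [ inj₁ , [ inj₂ , flip contradiction z∉C ] ] (A∪B∪C z)
    twice∉ : ∀ {X u d} → IsSubgroup X → X u → ¬ X d → ¬ X ((u +V d) +V d)
    twice∉ {X} {u} {d} X-subgroup u∈ d∉ u+d+d∈ =
      ∈-∉⇒+∉ X-subgroup u∈ (d∉ ∘ ½∈ X-subgroup m 2m≡1) (subst X (+V-assoc u d d) u+d+d∈)
    three-points : ∀ {d e} → ¬ (A d ⊎ B d) → C d → ¬ C e → ⊥
    three-points {d} {e} d∉A∪B d∈C e∉C = pigeonhole (A∪B e∉C) (A∪B e₁∉C) (A∪B (∉-∈⇒+∉ C-subgroup e₁∉C d∈C))
      where
      e₁∉C : ¬ C (e +V d)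
      e₁∉C = ∉-∈⇒+∉ C-subgroup e∉C d∈C
      pigeonhole : A e ⊎ B e → A (e +V d) ⊎ B (e +V d) → A ((e +V d) +V d) ⊎ B ((e +V d) +V d) → ⊥
      pigeonhole (inj₁ e∈A) (inj₁ e₁∈A) _ = ∈-∉⇒+∉ A-subgroup e∈A (d∉A∪B ∘ inj₁) e₁∈A
      pigeonhole (inj₂ e∈B) (inj₂ e₁∈B) _ = ∈-∉⇒+∉ B-subgroup e∈B (d∉A∪B ∘ inj₂) e₁∈B
      pigeonhole _ (inj₁ e₁∈A) (inj₁ e₂∈A) = ∈-∉⇒+∉ A-subgroup e₁∈A (d∉A∪B ∘ inj₁) e₂∈A
      pigeonhole _ (inj₂ e₁∈B) (inj₂ e₂∈B) = ∈-∉⇒+∉ B-subgroup e₁∈B (d∉A∪B ∘ inj₂) e₂∈B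
      pigeonhole (inj₁ e∈A) (inj₂ _) (inj₁ e₂∈A) = twice∉ A-subgroup e∈A (d∉A∪B ∘ inj₁) e₂∈A
      pigeonhole (inj₂ e∈B) (inj₁ _) (inj₂ e₂∈B) = twice∉ B-subgroup e∈B (d∉A∪B ∘ inj₂) e₂∈B

module AffineGraph {p r : ℕ} .{{_ : NonZero p}} (Γ : ColoredGraph (Vect p r) 3) (affine : AffineAut Γ) where

  open VectorSpace p r
  open ColoredGraph Γ renaming (sym to ψ-sym)

  colour : V → Fin 3
  colour = ψ 0V

  τ : V → V ↔ V
  τ t = proj₁ (proj₁ affine t)

  τ-aut : ∀ t → IsAut Γ (τ t)
  τ-aut t = proj₁ (proj₂ (proj₁ affine t))

  τ-apply : ∀ t x → to (τ t) x ≡ x +V t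
  τ-apply t = proj₂ (proj₂ (proj₁ affine t))

  stabiliser-additive : ∀ g → IsAut Γ g → to g 0V ≡ 0V → Additive (to g)
  stabiliser-additive g g-aut g0 = proj₁ (proj₂ affine g g-aut g0)

  stabiliser-scalar : ∀ g → IsAut Γ g → to g 0V ≡ 0V → ∀ a x → to g (a ·V x) ≡ a ·V to g x
  stabiliser-scalar g g-aut g0 = proj₂ (proj₂ affine g g-aut g0)

  ∘-aut : ∀ g h → IsAut Γ g → IsAut Γ h → IsAut Γ (g ↔-∘ h)
  ∘-aut g h g-aut h-aut x y x≢y = trans (g-aut _ _ (to-≢ h x≢y)) (h-aut x y x≢y)

  ψ-translate : ∀ x y → x ≢ y → ψ x y ≡ colour (y -V x)
  ψ-translate x y x≢y = begin
    ψ x y                                        ≡⟨ τ-aut (-V x) x y x≢y ⟨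
    ψ (to (τ (-V x)) x) (to (τ (-V x)) y)
      ≡⟨ cong₂ ψ (trans (τ-apply (-V x) x) (+V-inverseʳ x)) (τ-apply (-V x) y) ⟩
    colour (y -V x)                              ∎
    where open ≡-Reasoning

  colour-V : ∀ z → z ≢ 0V → colour (-V z) ≡ colour z
  colour-V z z≢0 = begin
    colour (-V z)      ≡⟨ cong colour (+V-identityˡ (-V z)) ⟨
    colour (0V -V z)   ≡⟨ ψ-translate z 0V z≢0 ⟨
    ψ z 0V             ≡⟨ ψ-sym z 0V z≢0 ⟩
    colour z           ∎
    where open ≡-Reasoning

  recentre : V ↔ V → V ↔ V
  recentre g = τ (-V to g 0V) ↔-∘ g

  recentre-apply : ∀ g z → to (recentre g) z ≡ to g z -V to g 0V
  recentre-apply g z = τ-apply (-V to g 0V) (to g z)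

  recentre-0 : ∀ g → to (recentre g) 0V ≡ 0V
  recentre-0 g = trans (recentre-apply g 0V) (+V-inverseʳ (to g 0V))

  recentre-aut : ∀ g → IsAut Γ g → IsAut Γ (recentre g)
  recentre-aut g g-aut = ∘-aut (τ (-V to g 0V)) g (τ-aut _) g-aut

  aut-affine : ∀ g → IsAut Γ g → Additive (to (recentre g)) × (∀ z → to g z ≡ to (recentre g) z +V to g 0V)
  aut-affine g g-aut =
    stabiliser-additive (recentre g) (recentre-aut g g-aut) (recentre-0 g) ,
    λ z → trans (sym (//-rightDividesˡ (to g 0V) (to g z))) (cong (_+V to g 0V) (sym (recentre-apply g z)))

  stabiliser-colour : ∀ g {z} → IsAut Γ g → to g 0V ≡ 0V → z ≢ 0V → colour (to g z) ≡ colour z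
  stabiliser-colour g {z} g-aut g0 z≢0 = trans (cong (λ o → ψ o (to g z)) (sym g0)) (g-aut 0V z (z≢0 ∘ sym))

  module _ (edge-transitive : EdgeTransitive Γ) where

    same-colour⇒stabiliser-sends-± : ∀ {x y} → x ≢ 0V → y ≢ 0V → colour x ≡ colour y →
      ∃ λ g → IsAut Γ g × to g 0V ≡ 0V × (to g x ≡ y ⊎ to g x ≡ -V y)
    same-colour⇒stabiliser-sends-± {x} {y} x≢0 y≢0 same
      with edge-transitive 0V x 0V y (x≢0 ∘ sym) (y≢0 ∘ sym) same
    ... | g , g-aut , inj₁ (g0 , gx) = g , g-aut , g0 , inj₁ gx
    ... | g , g-aut , inj₂ (g0 , gx) = recentre g , recentre-aut g g-aut , recentre-0 g , inj₂ (begin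
      to (recentre g) x    ≡⟨ recentre-apply g x ⟩
      to g x -V to g 0V    ≡⟨ cong₂ _-V_ gx g0 ⟩
      0V -V y              ≡⟨ +V-identityˡ (-V y) ⟩
      -V y                 ∎)
      where open ≡-Reasoning

    scalar-respects-colour : ∀ a {x y} → x ≢ 0V → y ≢ 0V → colour x ≡ colour y →
      a ·V x ≢ 0V → a ·V y ≢ 0V → colour (a ·V x) ≡ colour (a ·V y)
    scalar-respects-colour a {x} {y} x≢0 y≢0 same ax≢0 ay≢0
      with g , g-aut , g0 , gx≡±y ← same-colour⇒stabiliser-sends-± x≢0 y≢0 same = begin
      colour (a ·V x)           ≡⟨ stabiliser-colour g g-aut g0 ax≢0 ⟨
      colour (to g (a ·V x))    ≡⟨ cong colour (stabiliser-scalar g g-aut g0 a x) ⟩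
      colour (a ·V to g x)      ≡⟨ sign-irrelevant gx≡±y ⟩
      colour (a ·V y)           ∎
      where
      open ≡-Reasoning
      sign-irrelevant : to g x ≡ y ⊎ to g x ≡ -V y → colour (a ·V to g x) ≡ colour (a ·V y)
      sign-irrelevant (inj₁ gx≡y) = cong (colour ∘ (a ·V_)) gx≡y
      sign-irrelevant (inj₂ gx≡-y) = begin
        colour (a ·V to g x)    ≡⟨ cong (colour ∘ (a ·V_)) gx≡-y ⟩
        colour (a ·V (-V y))    ≡⟨ cong colour (additive⇒-V (·V-additive a) y) ⟩
        colour (-V (a ·V y))    ≡⟨ colour-V (a ·V y) ay≢0 ⟩
        colour (a ·V y)         ∎

  data Generated (c : Fin 3) : V → Set where
    gen-0 : Generated c 0V
    gen-+ : ∀ {z t} → Generated c z → t ≢ 0V → colour t ≡ c → Generated c (z +V t)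

  Generated-subgroup : ∀ c → IsSubgroup (Generated c)
  Generated-subgroup c = record { 0∈ = gen-0 ; +∈ = +∈ ; -∈ = -∈ }
    where
    +∈ : ∀ {x y} → Generated c x → Generated c y → Generated c (x +V y)
    +∈ {x} x∈ gen-0 = subst (Generated c) (sym (+V-identityʳ x)) x∈
    +∈ {x} x∈ (gen-+ {z} {t} z∈ t≢0 t-colour) =
      subst (Generated c) (+V-assoc x z t) (gen-+ (+∈ x∈ z∈) t≢0 t-colour)
    -∈ : ∀ {x} → Generated c x → Generated c (-V x)
    -∈ gen-0 = subst (Generated c) (sym ε⁻¹≈ε) gen-0
    -∈ (gen-+ {z} {t} z∈ t≢0 t-colour) =
      subst (Generated c) (⁻¹-∙-comm z t) (gen-+ (-∈ z∈) (-V-≢0 t≢0) (trans (colour-V t t≢0) t-colour))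

  Generated-colour : ∀ z → z ≢ 0V → Generated (colour z) z
  Generated-colour z z≢0 = subst (Generated (colour z)) (+V-identityˡ z) (gen-+ gen-0 z≢0 refl)

  conjugate-aut : ∀ σ π → Induces Γ σ π → ∀ k → IsAut Γ k → IsAut Γ (σ ↔-∘ (k ↔-∘ ↔-sym σ))
  conjugate-aut σ π σ-induces k k-aut a b a≢b = begin
    ψ (to σ (to k a')) (to σ (to k b'))   ≡⟨ σ-induces _ _ (to-≢ k a'≢b') ⟩
    π ⟨$⟩ʳ ψ (to k a') (to k b')          ≡⟨ cong (π ⟨$⟩ʳ_) (k-aut a' b' a'≢b') ⟩
    π ⟨$⟩ʳ ψ a' b'                        ≡⟨ σ-induces a' b' a'≢b' ⟨
    ψ (to σ a') (to σ b')                 ≡⟨ cong₂ ψ (strictlyInverseˡ σ a) (strictlyInverseˡ σ b) ⟩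
    ψ a b                                 ∎
    where
    open ≡-Reasoning
    a' b' : V
    a' = from σ a
    b' = from σ b
    a'≢b' : a' ≢ b'
    a'≢b' = to-≢ (↔-sym σ) a≢b

  conjugate⁻¹-aut : ∀ σ π → Induces Γ σ π → ∀ k → IsAut Γ k → IsAut Γ (↔-sym σ ↔-∘ (k ↔-∘ σ))
  conjugate⁻¹-aut σ π σ-induces k k-aut a b a≢b = to-injective π (begin
    π ⟨$⟩ʳ ψ a' b'                        ≡⟨ σ-induces a' b' a'≢b' ⟨
    ψ (to σ a') (to σ b')                 ≡⟨ cong₂ ψ (strictlyInverseˡ σ _) (strictlyInverseˡ σ _) ⟩
    ψ (to k (to σ a)) (to k (to σ b))     ≡⟨ k-aut _ _ (to-≢ σ a≢b) ⟩
    ψ (to σ a) (to σ b)                   ≡⟨ σ-induces a b a≢b ⟩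
    π ⟨$⟩ʳ ψ a b                          ∎)
    where
    open ≡-Reasoning
    a' b' : V
    a' = from σ (to k (to σ a))
    b' = from σ (to k (to σ b))
    a'≢b' : a' ≢ b'
    a'≢b' = to-≢ (↔-sym σ) (to-≢ k (to-≢ σ a≢b))

  induced-fixing-0 : ColorSymmetric Γ → ∀ π → ∃ λ σ → Induces Γ σ π × to σ 0V ≡ 0V
  induced-fixing-0 colour-symmetric π with σ , σ-induces ← colour-symmetric π =
    recentre σ , (λ x y x≢y → trans (τ-aut _ _ _ (to-≢ σ x≢y)) (σ-induces x y x≢y)) , recentre-0 σ

  module FixingExt (σ : V ↔ V) (π : Permutation′ 3) (σ-induces : Induces Γ σ π) (σ0 : to σ 0V ≡ 0V) where

    s : V → V
    s = to σ

    colour-σ : ∀ {z} → z ≢ 0V → colour (s z) ≡ π ⟨$⟩ʳ colour z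
    colour-σ {z} z≢0 = trans (cong (λ o → ψ o (s z)) (sym σ0)) (σ-induces 0V z (z≢0 ∘ sym))

    σ-≢0 : ∀ {z} → z ≢ 0V → s z ≢ 0V
    σ-≢0 z≢0 sz≡0 = z≢0 (to-injective σ (trans sz≡0 (sym σ0)))

    σ⁻¹-0 : from σ 0V ≡ 0V
    σ⁻¹-0 = trans (cong (from σ) (sym σ0)) (strictlyInverseʳ σ 0V)

    σ-Generated : ∀ {c z} → Generated c z → Generated (π ⟨$⟩ʳ c) (s z)
    σ-Generated gen-0 = subst (Generated _) (sym σ0) gen-0
    σ-Generated {c} (gen-+ {z} {t} z∈ t≢0 t-colour) =
      subst (Generated _) (x+[y-x]≡y (s z) (s (z +V t))) (gen-+ (σ-Generated z∈) t'≢0 t'-colour)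
      where
      open ≡-Reasoning
      t' : V
      t' = s (z +V t) -V s z
      z≢z+t : z ≢ z +V t
      z≢z+t z≡z+t = t≢0 (identityʳ-unique z t (sym z≡z+t))
      t'≢0 : t' ≢ 0V
      t'≢0 t'≡0 = z≢z+t (sym (to-injective σ (x∙y⁻¹≈ε⇒x≈y _ _ t'≡0)))
      t'-colour : colour t' ≡ π ⟨$⟩ʳ c
      t'-colour = begin
        colour t'                          ≡⟨ ψ-translate (s z) (s (z +V t)) (to-≢ σ z≢z+t) ⟨
        ψ (s z) (s (z +V t))               ≡⟨ σ-induces z (z +V t) z≢z+t ⟩
        π ⟨$⟩ʳ ψ z (z +V t)                ≡⟨ cong (π ⟨$⟩ʳ_) (ψ-translate z (z +V t) z≢z+t) ⟩
        π ⟨$⟩ʳ colour ((z +V t) -V z)      ≡⟨ cong (λ u → π ⟨$⟩ʳ colour u) ([x+y]-x≡y z t) ⟩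
        π ⟨$⟩ʳ colour t                    ≡⟨ cong (π ⟨$⟩ʳ_) t-colour ⟩
        π ⟨$⟩ʳ c                           ∎

    AdditiveAt : V → Set
    AdditiveAt x = ∀ w → s (w +V x) ≡ s w +V s x

    AdditiveAt-subgroup : IsSubgroup AdditiveAt
    AdditiveAt-subgroup = record { 0∈ = 0∈ ; +∈ = +∈ ; -∈ = -∈ }
      where
      open ≡-Reasoning
      0∈ : AdditiveAt 0V
      0∈ w = begin
        s (w +V 0V)    ≡⟨ cong s (+V-identityʳ w) ⟩
        s w            ≡⟨ +V-identityʳ (s w) ⟨
        s w +V 0V      ≡⟨ cong (s w +V_) σ0 ⟨
        s w +V s 0V    ∎
      +∈ : ∀ {x y} → AdditiveAt x → AdditiveAt y → AdditiveAt (x +V y)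
      +∈ {x} {y} x∈ y∈ w = begin
        s (w +V (x +V y))       ≡⟨ cong s (+V-assoc w x y) ⟨
        s ((w +V x) +V y)       ≡⟨ y∈ (w +V x) ⟩
        s (w +V x) +V s y       ≡⟨ cong (_+V s y) (x∈ w) ⟩
        (s w +V s x) +V s y     ≡⟨ +V-assoc (s w) (s x) (s y) ⟩
        s w +V (s x +V s y)     ≡⟨ cong (s w +V_) (y∈ x) ⟨
        s w +V s (x +V y)       ∎
      -∈ : ∀ {x} → AdditiveAt x → AdditiveAt (-V x)
      -∈ {x} x∈ w = begin
        s (w -V x)          ≡⟨ minus w ⟩
        s w -V s x          ≡⟨ cong (s w +V_) negate ⟨
        s w +V s (-V x)     ∎
        where
        minus : ∀ u → s (u -V x) ≡ s u -V s x
        minus u = x≈z//y (s (u -V x)) (s x) (s u)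
          (trans (sym (x∈ (u -V x))) (cong s (//-rightDividesˡ x u)))
        negate : s (-V x) ≡ -V s x
        negate = begin
          s (-V x)          ≡⟨ cong s (+V-identityˡ (-V x)) ⟨
          s (0V -V x)       ≡⟨ minus 0V ⟩
          s 0V -V s x       ≡⟨ cong (_-V s x) σ0 ⟩
          0V -V s x         ≡⟨ +V-identityˡ (-V s x) ⟩
          -V s x            ∎

    AdditiveAt-stabiliser : ∀ k → IsAut Γ k → to k 0V ≡ 0V → ∀ {x} → AdditiveAt x → AdditiveAt (to k x)
    AdditiveAt-stabiliser k k-aut k0 {x} x∈ w = begin
      s (w +V to k x)               ≡⟨ cong (λ u → s (u +V to k x)) (strictlyInverseˡ k w) ⟨
      s (to k w' +V to k x)         ≡⟨ cong s (stabiliser-additive k k-aut k0 w' x) ⟨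
      s (to k (w' +V x))            ≡⟨ σ∘k (w' +V x) ⟩
      to g (s (w' +V x))            ≡⟨ cong (to g) (x∈ w') ⟩
      to g (s w' +V s x)            ≡⟨ stabiliser-additive g (conjugate-aut σ π σ-induces k k-aut) g0 (s w') (s x) ⟩
      to g (s w') +V to g (s x)     ≡⟨ cong₂ _+V_ (σ∘k w') (σ∘k x) ⟨
      s (to k w') +V s (to k x)     ≡⟨ cong (λ u → s u +V s (to k x)) (strictlyInverseˡ k w) ⟩
      s w +V s (to k x)             ∎
      where
      open ≡-Reasoning
      w' : V
      w' = from k w
      g : V ↔ V
      g = σ ↔-∘ (k ↔-∘ ↔-sym σ)
      σ∘k : ∀ z → s (to k z) ≡ to g (s z)
      σ∘k z = cong (s ∘ to k) (sym (strictlyInverseʳ σ z))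
      g0 : to g 0V ≡ 0V
      g0 = trans (cong (s ∘ to k) σ⁻¹-0) (trans (cong s k0) σ0)

    conjugated-τ : V → V ↔ V
    conjugated-τ x = σ ↔-∘ (τ x ↔-∘ ↔-sym σ)

    conjugated-τ-aut : ∀ x → IsAut Γ (conjugated-τ x)
    conjugated-τ-aut x = conjugate-aut σ π σ-induces (τ x) (τ-aut x)

    -- σ τₓ σ⁻¹ = τ_{σ x} ∘ twist x, where twist x fixes 0 and is therefore linear.
    twist : V → V → V
    twist x = to (recentre (conjugated-τ x))

    twist-additive : ∀ x → Additive (twist x)
    twist-additive x = proj₁ (aut-affine (conjugated-τ x) (conjugated-τ-aut x))

    twist-decomposition : ∀ x z → to (conjugated-τ x) z ≡ twist x z +V to (conjugated-τ x) 0V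
    twist-decomposition x = proj₂ (aut-affine (conjugated-τ x) (conjugated-τ-aut x))

    twist-injective : ∀ x {a b} → twist x a ≡ twist x b → a ≡ b
    twist-injective x {a} {b} eq = to-injective (conjugated-τ x) (begin
      to (conjugated-τ x) a                               ≡⟨ twist-decomposition x a ⟩
      twist x a +V to (conjugated-τ x) 0V                 ≡⟨ cong (_+V to (conjugated-τ x) 0V) eq ⟩
      twist x b +V to (conjugated-τ x) 0V                 ≡⟨ twist-decomposition x b ⟨
      to (conjugated-τ x) b                               ∎)
      where open ≡-Reasoning

    σ-shift : ∀ x u → s (u +V x) ≡ twist x (s u) +V s x
    σ-shift x u = begin
      s (u +V x)                                ≡⟨ cong s (τ-apply x u) ⟨
      s (to (τ x) u)                            ≡⟨ cong (s ∘ to (τ x)) (strictlyInverseʳ σ u) ⟨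
      to (conjugated-τ x) (s u)                 ≡⟨ twist-decomposition x (s u) ⟩
      twist x (s u) +V to (conjugated-τ x) 0V   ≡⟨ cong (twist x (s u) +V_) conjugated-τ-0 ⟩
      twist x (s u) +V s x                      ∎
      where
      open ≡-Reasoning
      conjugated-τ-0 : to (conjugated-τ x) 0V ≡ s x
      conjugated-τ-0 = cong s (trans (τ-apply x (from σ 0V)) (trans (cong (_+V x) σ⁻¹-0) (+V-identityˡ x)))

    pulled-back-τ : V → V ↔ V
    pulled-back-τ y = ↔-sym σ ↔-∘ (τ y ↔-∘ σ)

    σ-pulled-back-τ : ∀ y z → s (to (pulled-back-τ y) z) ≡ s z +V y
    σ-pulled-back-τ y z = trans (strictlyInverseˡ σ _) (τ-apply y (s z))

    pulled-back-τ-shift : ∀ y z x →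
      to (pulled-back-τ y) (z +V x) ≡ to (pulled-back-τ y) z +V to (recentre (pulled-back-τ y)) x
    pulled-back-τ-shift y z x
      with L-additive , decomposition ←
             aut-affine (pulled-back-τ y) (conjugate⁻¹-aut σ π σ-induces (τ y) (τ-aut y)) = begin
      k (z +V x)                 ≡⟨ decomposition (z +V x) ⟩
      L (z +V x) +V k 0V         ≡⟨ cong (_+V k 0V) (L-additive z x) ⟩
      (L z +V L x) +V k 0V       ≡⟨ xy∙z≈xz∙y (L z) (L x) (k 0V) ⟩
      (L z +V k 0V) +V L x       ≡⟨ cong (_+V L x) (decomposition z) ⟨
      k z +V L x                 ∎
      where
      open ≡-Reasoning
      k L : V → V
      k = to (pulled-back-τ y)
      L = to (recentre (pulled-back-τ y))

    -- Writing σ⁻¹ τ_y σ = τ_c ∘ L, the commutator of τₓ and σ⁻¹ τ_y σ is the translation by x - L x.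
    -- Conjugated by σ it becomes the commutator of σ τₓ σ⁻¹ and τ_y, again a translation.
    commutator-vector : V → V → V
    commutator-vector x y = x -V to (recentre (pulled-back-τ y)) x

    σ-translates-along-commutator : ∀ x y₀ q →
      s (q +V commutator-vector x (twist x y₀)) ≡ s q +V (twist x y₀ -V y₀)
    σ-translates-along-commutator x y₀ q = begin
      s (q +V x')          ≡⟨ cong s kz ⟨
      s (k z)              ≡⟨ σ-pulled-back-τ y z ⟩
      s z +V y             ≡⟨ cong (_+V y) sz ⟩
      (s q -V y₀) +V y     ≡⟨ xy∙z≈x∙zy (s q) (-V y₀) y ⟩
      s q +V (y -V y₀)     ∎
      where
      open ≡-Reasoning
      y x' z : V
      y = twist x y₀
      x' = commutator-vector x y
      z = from (pulled-back-τ y) (q +V x')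
      k L : V → V
      k = to (pulled-back-τ y)
      L = to (recentre (pulled-back-τ y))
      kz : k z ≡ q +V x'
      kz = strictlyInverseˡ (pulled-back-τ y) (q +V x')
      k[z+x] : k (z +V x) ≡ q +V x
      k[z+x] = begin
        k (z +V x)             ≡⟨ pulled-back-τ-shift y z x ⟩
        k z +V L x             ≡⟨ cong (_+V L x) kz ⟩
        (q +V x') +V L x       ≡⟨ +V-assoc q x' (L x) ⟩
        q +V (x' +V L x)       ≡⟨ cong (q +V_) (//-rightDividesˡ (L x) x) ⟩
        q +V x                 ∎
      twist-sq : twist x (s q) ≡ twist x (s z +V y₀)
      twist-sq = ∙-cancelʳ (s x) _ _ (begin
        twist x (s q) +V s x            ≡⟨ σ-shift x q ⟨
        s (q +V x)                      ≡⟨ cong s k[z+x] ⟨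
        s (k (z +V x))                  ≡⟨ σ-pulled-back-τ y (z +V x) ⟩
        s (z +V x) +V y                 ≡⟨ cong (_+V y) (σ-shift x z) ⟩
        (twist x (s z) +V s x) +V y     ≡⟨ xy∙z≈xz∙y (twist x (s z)) (s x) y ⟩
        (twist x (s z) +V y) +V s x     ≡⟨ cong (_+V s x) (twist-additive x (s z) y₀) ⟨
        twist x (s z +V y₀) +V s x      ∎)
      sz : s z ≡ s q -V y₀
      sz = x≈z//y (s z) y₀ (s q) (sym (twist-injective x twist-sq))

    commutator : ∀ {x w} → s (w +V x) ≢ s w +V s x → ∃ λ x' → x' ≢ 0V × AdditiveAt x'
    commutator {x} {w} not-additive = x' , x'≢0 , x'∈
      where
      y x' : V
      y = twist x (s w)
      x' = commutator-vector x y
      σx' : s x' ≡ y -V s w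
      σx' = begin
        s x'                   ≡⟨ cong s (+V-identityˡ x') ⟨
        s (0V +V x')           ≡⟨ σ-translates-along-commutator x (s w) 0V ⟩
        s 0V +V (y -V s w)     ≡⟨ cong (_+V (y -V s w)) σ0 ⟩
        0V +V (y -V s w)       ≡⟨ +V-identityˡ (y -V s w) ⟩
        y -V s w               ∎
        where open ≡-Reasoning
      x'∈ : AdditiveAt x'
      x'∈ q = trans (σ-translates-along-commutator x (s w) q) (cong (s q +V_) (sym σx'))
      x'≢0 : x' ≢ 0V
      x'≢0 x'≡0 = not-additive (begin
        s (w +V x)        ≡⟨ σ-shift x w ⟩
        y +V s x          ≡⟨ cong (_+V s x) (x∙y⁻¹≈ε⇒x≈y y (s w) (trans (sym σx') (trans (cong s x'≡0) σ0))) ⟩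
        s w +V s x        ∎)
        where open ≡-Reasoning

    module _ (edge-transitive : EdgeTransitive Γ) where
      open IsSubgroup AdditiveAt-subgroup

      colour-class⊆AdditiveAt : ∀ {x t} → x ≢ 0V → AdditiveAt x → t ≢ 0V → colour t ≡ colour x → AdditiveAt t
      colour-class⊆AdditiveAt x≢0 x∈ t≢0 same
        with g , g-aut , g0 , gx≡±t ← same-colour⇒stabiliser-sends-± edge-transitive x≢0 t≢0 (sym same)
        = ±∈ (AdditiveAt-stabiliser g g-aut g0 x∈) gx≡±t

      Generated⊆AdditiveAt : ∀ {x z} → x ≢ 0V → AdditiveAt x → Generated (colour x) z → AdditiveAt z
      Generated⊆AdditiveAt x≢0 x∈ gen-0 = 0∈
      Generated⊆AdditiveAt x≢0 x∈ (gen-+ z∈ t≢0 t-colour) =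
        +∈ (Generated⊆AdditiveAt x≢0 x∈ z∈) (colour-class⊆AdditiveAt x≢0 x∈ t≢0 t-colour)

      σ-additive : (∀ c → ¬ ¬ (∀ z → Generated c z)) → ¬ ¬ Additive s
      σ-additive generated-total not-additive =
        V-¬∀⇒¬¬∃¬ not-everywhere λ (x , x∉) → V-¬∀⇒¬¬∃¬ x∉ λ (w , not-additive-at) →
          let x' , x'≢0 , x'∈ = commutator not-additive-at
          in generated-total (colour x') λ total → not-everywhere (Generated⊆AdditiveAt x'≢0 x'∈ ∘ total)
        where
        not-everywhere : ¬ (∀ x → AdditiveAt x)
        not-everywhere everywhere = not-additive (λ x y → everywhere y x)

module TotallySymmetricGraph {p r : ℕ} .{{_ : NonZero p}} (Γ : ColoredGraph (Vect p r) 3)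
                             (tsc : TotallySymmetric Γ) (affine : AffineAut Γ) where
  open VectorSpace p r
  open AffineGraph Γ affine

  edge-transitive : EdgeTransitive Γ
  edge-transitive = proj₁ tsc

  colour-symmetric : ColorSymmetric Γ
  colour-symmetric = proj₂ tsc

  Generated-transfer : ∀ c c' → (∀ z → Generated c' z) → ∀ z → Generated c z
  Generated-transfer c c' total z
    with σ , σ-induces , σ0 ← induced-fixing-0 colour-symmetric (transpose c' c) =
    subst₂ Generated (transpose-sends c' c) (strictlyInverseˡ σ z) (σ-Generated (total (from σ z)))
    where open FixingExt σ (transpose c' c) σ-induces σ0

  Generated-cover : ∀ z → Generated 0F z ⊎ Generated 1F z ⊎ Generated 2F z
  Generated-cover z with ≡-dec _≟_ z 0V
  ... | yes refl = inj₁ gen-0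
  ... | no z≢0 with colour z | Generated-colour z z≢0
  ...   | 0F | z∈ = inj₁ z∈
  ...   | 1F | z∈ = inj₂ (inj₁ z∈)
  ...   | 2F | z∈ = inj₂ (inj₂ z∈)

  module _ (m : ℕ) (2m≡1 : (m * 2) % p ≡ 1) where

    Generated-total : ∀ c → ¬ ¬ (∀ z → Generated c z)
    Generated-total c not-total =
      three-subgroup-cover⇒third-total m 2m≡1
        (Generated-subgroup 0F) (Generated-subgroup 1F) (Generated-subgroup 2F)
        Generated-cover
        (not-total ∘ Generated-transfer c 0F) (not-total ∘ Generated-transfer c 1F)
        (not-total ∘ Generated-transfer c 2F)

    permutation-fixing-colour-fixes-multiple : ∀ π a {w} → w ≢ 0V → a ·V w ≢ 0V →
      π ⟨$⟩ʳ colour w ≡ colour w → ¬ ¬ (π ⟨$⟩ʳ colour (a ·V w) ≡ colour (a ·V w))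
    permutation-fixing-colour-fixes-multiple π a {w} w≢0 aw≢0 π-fixes
      with σ , σ-induces , σ0 ← induced-fixing-0 colour-symmetric π =
      ¬¬-map fixes (σ-additive edge-transitive Generated-total)
      where
      open FixingExt σ π σ-induces σ0
      fixes : Additive s → π ⟨$⟩ʳ colour (a ·V w) ≡ colour (a ·V w)
      fixes s-additive = begin
        π ⟨$⟩ʳ colour (a ·V w)    ≡⟨ colour-σ aw≢0 ⟨
        colour (s (a ·V w))       ≡⟨ cong colour σ-aw ⟩
        colour (a ·V s w)         ≡⟨ scalar-respects-colour edge-transitive a (σ-≢0 w≢0) w≢0
                                       (trans (colour-σ w≢0) π-fixes) (σ-≢0 aw≢0 ∘ trans σ-aw) aw≢0 ⟩
        colour (a ·V w)           ∎
        where
        open ≡-Reasoning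
        σ-aw : s (a ·V w) ≡ a ·V s w
        σ-aw = additive⇒·V s-additive a w

  multiple-colour : Prime p → ∀ a {w} → w ≢ 0V → a ·V w ≢ 0V → colour (a ·V w) ≡ colour w
  multiple-colour p-prime a {w} w≢0 aw≢0 with p ℕ.≟ 2
  ... | yes p≡2 with ·V-over-F₂ p≡2 a w
  ...   | inj₁ aw≡0 = contradiction aw≡0 aw≢0
  ...   | inj₂ aw≡w = cong colour aw≡w
  multiple-colour p-prime a {w} w≢0 aw≢0 | no p≢2 with m , 2m≡1 ← prime≢2⇒½ p-prime p≢2 =
    decidable-stable (colour (a ·V w) ≟ colour w) λ colours-differ →
      let π , π-fixes , π-moves = fix-and-move (colour w) (colour (a ·V w)) (colours-differ ∘ sym)
      in permutation-fixing-colour-fixes-multiple m 2m≡1 π a w≢0 aw≢0 π-fixes π-moves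

mainTheorem8 : (p r : ℕ) .{{_ : NonZero p}} → Prime p →
    (Γ : ColoredGraph (Vect p r) 3) → TotallySymmetric Γ → AffineAut Γ →
    ∀ (w u v : Vect p r) → w ≢ 0V → u ∈Span w → v ∈Span w → u ≢ 0V → v ≢ 0V →
    ColoredGraph.ψ Γ 0V v ≡ ColoredGraph.ψ Γ 0V u
mainTheorem8 p r p-prime Γ tsc affine w _ _ w≢0 (a , refl) (b , refl) aw≢0 bw≢0 =
  trans (multiple-colour p-prime b w≢0 bw≢0) (sym (multiple-colour p-prime a w≢0 aw≢0))
  where open TotallySymmetricGraph Γ tsc affine
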